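{- For every $n\ge 3$, the coefficient of $x$ in $R_n^{(2\le\max,\emptyset,0,0)}(x)$ equals $c(n,3)$, the number of permutations of $\{1,\dots,n\}$ having exactly three cycles.
   Context: For $\sigma=\sigma_1\cdots\sigma_n\in S_n$, $\sigma_i$ matches $MMP(2\le\max,\emptyset,0,0)$ if no $j<i$ has $\sigma_j>\sigma_i$, and, with $\sigma_m=\max\{\sigma_{i+1},\dots,\sigma_n\}$ ($i<n$), at least $2$ of $\sigma_{i+1},\dots,\sigma_m$ are greater than $\sigma_i$. $mmp^{(2\le\max,\emptyset,0,0)}(\sigma)$ is the number of such $i$, and $R_n^{(2\le\max,\emptyset,0,0)}(x)=\sum_{\sigma\in S_n}x^{mmp^{(2\le\max,\emptyset,0,0)}(\sigma)}$. -}

module Defs where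

open import Data.Nat using (ℕ; zero; suc; _<ᵇ_; _≡ᵇ_; _≤ᵇ_; _⊔_)
open import Data.Bool using (Bool; true; false; _∧_; not; if_then_else_)
open import Data.List using (List; []; _∷_; _∷ʳ_; length; map; concatMap; filterᵇ; upTo; foldr)
open import Data.Bool.ListAction using (all; any)

-- Convention: a permutation σ ∈ S_n is written in one-line notation
-- σ_1 ⋯ σ_n as a list of length n whose entries are the values 0,…,n-1
-- (i.e. {1,…,n} shifted down by one; all comparisons are unaffected),
-- each occurring exactly once.

words : ℕ → ℕ → List (List ℕ)
words n zero    = [] ∷ []
words n (suc k) = concatMap (λ a → map (a ∷_) (words n k)) (upTo n)

distinct : List ℕ → Bool
distinct []       = true
distinct (a ∷ xs) = not (any (λ b → a ≡ᵇ b) xs) ∧ distinct xs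

perms : ℕ → List (List ℕ)
perms n = filterᵇ distinct (words n n)

countᵇ : {A : Set} → (A → Bool) → List A → ℕ
countᵇ p xs = length (filterᵇ p xs)

maxList : List ℕ → ℕ
maxList = foldr _⊔_ 0

upToValue : ℕ → List ℕ → List ℕ
upToValue m []       = []
upToValue m (b ∷ xs) = if b ≡ᵇ m then b ∷ [] else b ∷ upToValue m xs

-- For σ_i = a with suffix rest = σ_{i+1} ⋯ σ_n: with σ_m the maximum of rest,
-- at least 2 of σ_{i+1},…,σ_m exceed a.  (i < n  ⇔  rest nonempty.)
rightCond : ℕ → List ℕ → Bool
rightCond a []         = false
rightCond a rest@(_ ∷ _) = 2 ≤ᵇ countᵇ (λ b → a <ᵇ b) (upToValue (maxList rest) rest)

matchesMMP : List ℕ → ℕ → List ℕ → Bool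
matchesMMP prefix a rest = not (any (λ b → a <ᵇ b) prefix) ∧ rightCond a rest

mmpAux : List ℕ → List ℕ → ℕ
mmpAux prefix []         = 0
mmpAux prefix (a ∷ rest) =
  (if matchesMMP prefix a rest then 1 else 0) + mmpAux (prefix ∷ʳ a) rest
  where open import Data.Nat using (_+_)

mmp : List ℕ → ℕ
mmp σ = mmpAux [] σ

-- coefficient of x^k in R_n^{(2≤max,∅,0,0)}(x) = Σ_{σ∈S_n} x^{mmp(σ)}
coeffR : ℕ → ℕ → ℕ
coeffR n k = countᵇ (λ σ → mmp σ ≡ᵇ k) (perms n)

-- σ(i) for σ in one-line notation (default 0 outside range, never used)
apply : List ℕ → ℕ → ℕ
apply []       i       = 0
apply (a ∷ σ)  zero    = a
apply (a ∷ σ)  (suc i) = apply σ i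

applyPow : List ℕ → ℕ → ℕ → ℕ
applyPow σ zero    i = i
applyPow σ (suc k) i = apply σ (applyPow σ k i)

-- i is the smallest element of its cycle: σ^k(i) ≥ i for k = 1,…,n
-- (the cycle of i is {σ^k(i) : 1 ≤ k ≤ n})
isCycleMin : ℕ → List ℕ → ℕ → Bool
isCycleMin n σ i = all (λ k → i ≤ᵇ applyPow σ (suc k) i) (upTo n)

-- number of cycles of σ ∈ S_n (one smallest element per cycle)
numCycles : ℕ → List ℕ → ℕ
numCycles n σ = countᵇ (isCycleMin n σ) (upTo n)

c : ℕ → ℕ → ℕ
c n k = countᵇ (λ σ → numCycles n σ ≡ᵇ k) (perms n)

-- A left-to-right maximum (record) σ_i is an MMP match exactly when at least two records
-- follow it, so mmp σ = (number of records of σ) ∸ 2 and the coefficient of x^k, k ≥ 1, counts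
-- permutations with k + 2 records.  Records and cycles are equidistributed on S_n (both counted
-- by c(n,k)): each permutation of S_{n+1} arises uniquely from one of S_n, either by inserting a
-- new minimum at one of n + 1 positions (a new record only at the front) or by inserting n into
-- a cycle after one of n + 1 elements (a new cycle only after n itself), so both distributions
-- satisfy the Stirling recursion c(n+1,k) = c(n,k-1) + n c(n,k) with the same initial values.
module Submission where

open import Defs
open import Data.Bool using (Bool; true; false; _∧_; _∨_; not; if_then_else_; T)
open import Data.Bool.ListAction using (any)
open import Data.Bool.Properties using (T-∧; T-not-≡; T?; ∨-conicalˡ; ∨-conicalʳ)
open import Data.List using (List; []; _∷_; _∷ʳ_; _++_; length; map; upTo; applyUpTo; concatMap; cartesianProduct; cartesianProductWith)
open import Data.List.Properties using (upTo-∷ʳ; ∷-injective; length-map; length-applyUpTo)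
open import Data.List.Membership.Propositional using (_∈_)
open import Data.List.Membership.Propositional.Properties
  using (∈-upTo⁺; ∈-upTo⁻; ∈-map⁺; ∈-map⁻; ∈-filter⁺; ∈-filter⁻; ∈-cartesianProduct⁺; ∈-cartesianProduct⁻;
         ∈-cartesianProductWith⁺; ∈-cartesianProductWith⁻)
open import Data.List.Membership.Propositional.Properties.WithK using (unique∧set⇒bag)
open import Data.List.Relation.Binary.BagAndSetEquality using (∼bag⇒↭)
open import Data.List.Relation.Binary.Permutation.Propositional.Properties using (↭-length; filter-↭)
open import Data.List.Relation.Unary.Any using (here; there)
import Data.List.Relation.Unary.All as All
open import Data.List.Relation.Unary.All.Properties using (all⁺; all⁻; applyUpTo⁺₁; applyUpTo⁻)
import Data.List.Relation.Unary.AllPairs as AllPairs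
open import Data.List.Relation.Unary.Unique.Propositional using (Unique)
open import Data.List.Relation.Unary.Unique.Propositional.Properties using (cartesianProductWith⁺; cartesianProduct⁺; upTo⁺; filter⁺)
import Data.Fin as Fin
import Data.Fin.Properties as Fin
open import Data.Nat
open import Data.Nat.DivMod using (_%_; _/_; m≡m%n+[m/n]*n; m%n<n)
open import Data.Nat.ListAction using (sum)
open import Data.Nat.Properties
open import Data.Nat.Tactic.RingSolver using (solve-∀)
open import Data.Product using (∃; ∃₂; _×_; _,_; proj₁; proj₂)
open import Data.Sum using (_⊎_; inj₁; inj₂)
open import Function using (_∘_; id; Equivalence; mk⇔)
open import Relation.Nullary using (¬_; yes; no; contradiction)
open import Relation.Nullary.Reflects using (Reflects; ofʸ; ofⁿ; det; fromEquivalence; T-reflects)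
open import Relation.Binary.PropositionalEquality

reflects-true : ∀ {P : Set} {b} → Reflects P b → P → b ≡ true
reflects-true r p = det r (ofʸ p)

reflects-false : ∀ {P : Set} {b} → Reflects P b → ¬ P → b ≡ false
reflects-false r ¬p = det r (ofⁿ ¬p)

≡ᵇ-reflects-≡ : ∀ m n → Reflects (m ≡ n) (m ≡ᵇ n)
≡ᵇ-reflects-≡ m n = fromEquivalence (≡ᵇ⇒≡ m n) (≡⇒≡ᵇ m n)

<ᵇ-true : ∀ {m n} → m < n → (m <ᵇ n) ≡ true
<ᵇ-true = reflects-true (<ᵇ-reflects-< _ _)

<ᵇ-false : ∀ {m n} → n ≤ m → (m <ᵇ n) ≡ false
<ᵇ-false n≤m = reflects-false (<ᵇ-reflects-< _ _) (≤⇒≯ n≤m)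

≡ᵇ-true : ∀ {m n} → m ≡ n → (m ≡ᵇ n) ≡ true
≡ᵇ-true = reflects-true (≡ᵇ-reflects-≡ _ _)

≡ᵇ-false : ∀ {m n} → m ≢ n → (m ≡ᵇ n) ≡ false
≡ᵇ-false = reflects-false (≡ᵇ-reflects-≡ _ _)

T-⇔⇒≡ : ∀ {a b} → (T a → T b) → (T b → T a) → a ≡ b
T-⇔⇒≡ {true}  {true}  _ _ = refl
T-⇔⇒≡ {true}  {false} f _ = contradiction (f _) λ ()
T-⇔⇒≡ {false} {true}  _ g = contradiction (g _) λ ()
T-⇔⇒≡ {false} {false} _ _ = refl

≡ᵇ-false⇒≢ : ∀ {m n} → (m ≡ᵇ n) ≡ false → m ≢ n
≡ᵇ-false⇒≢ {m} m≢ᵇn refl with () ← trans (sym (≡ᵇ-true {m} refl)) m≢ᵇn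

indicator : Bool → ℕ
indicator true  = 1
indicator false = 0

module _ {A : Set} (p : A → Bool) where

  countᵇ-∷ : ∀ x xs → countᵇ p (x ∷ xs) ≡ indicator (p x) + countᵇ p xs
  countᵇ-∷ x xs with p x
  ... | true  = refl
  ... | false = refl

  countᵇ-++ : ∀ xs ys → countᵇ p (xs ++ ys) ≡ countᵇ p xs + countᵇ p ys
  countᵇ-++ []       ys = refl
  countᵇ-++ (x ∷ xs) ys = begin
    countᵇ p (x ∷ xs ++ ys)                         ≡⟨ countᵇ-∷ x (xs ++ ys) ⟩
    indicator (p x) + countᵇ p (xs ++ ys)           ≡⟨ cong (indicator (p x) +_) (countᵇ-++ xs ys) ⟩
    indicator (p x) + (countᵇ p xs + countᵇ p ys)   ≡⟨ +-assoc (indicator (p x)) _ _ ⟨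
    indicator (p x) + countᵇ p xs + countᵇ p ys     ≡⟨ cong (_+ countᵇ p ys) (countᵇ-∷ x xs) ⟨
    countᵇ p (x ∷ xs) + countᵇ p ys                 ∎
    where open ≡-Reasoning

countᵇ-map : ∀ {A B : Set} (p : B → Bool) (f : A → B) xs →
             countᵇ p (map f xs) ≡ countᵇ (p ∘ f) xs
countᵇ-map p f []       = refl
countᵇ-map p f (x ∷ xs) = trans (countᵇ-∷ p (f x) (map f xs))
  (trans (cong (indicator (p (f x)) +_) (countᵇ-map p f xs)) (sym (countᵇ-∷ (p ∘ f) x xs)))

countᵇ-cong : ∀ {A : Set} {p q : A → Bool} xs → (∀ {x} → x ∈ xs → p x ≡ q x) →
              countᵇ p xs ≡ countᵇ q xs
countᵇ-cong {p = p} {q} []       eq = refl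
countᵇ-cong {p = p} {q} (x ∷ xs) eq = begin
  countᵇ p (x ∷ xs)                 ≡⟨ countᵇ-∷ p x xs ⟩
  indicator (p x) + countᵇ p xs     ≡⟨ cong₂ (λ b m → indicator b + m) (eq (here refl)) (countᵇ-cong xs (eq ∘ there)) ⟩
  indicator (q x) + countᵇ q xs     ≡⟨ countᵇ-∷ q x xs ⟨
  countᵇ q (x ∷ xs)                 ∎
  where open ≡-Reasoning

countᵇ-false : ∀ {A : Set} (xs : List A) → countᵇ (λ _ → false) xs ≡ 0
countᵇ-false []       = refl
countᵇ-false (x ∷ xs) = countᵇ-false xs

countᵇ-cartesianProduct : ∀ {A B : Set} (p : A × B → Bool) xs ys →
  countᵇ p (cartesianProduct xs ys) ≡ sum (map (λ x → countᵇ (λ y → p (x , y)) ys) xs)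
countᵇ-cartesianProduct p []       ys = refl
countᵇ-cartesianProduct p (x ∷ xs) ys = begin
  countᵇ p (map (x ,_) ys ++ cartesianProduct xs ys)
    ≡⟨ countᵇ-++ p (map (x ,_) ys) _ ⟩
  countᵇ p (map (x ,_) ys) + countᵇ p (cartesianProduct xs ys)
    ≡⟨ cong₂ _+_ (countᵇ-map p (x ,_) ys) (countᵇ-cartesianProduct p xs ys) ⟩
  countᵇ (λ y → p (x , y)) ys + sum (map (λ x → countᵇ (λ y → p (x , y)) ys) xs)
    ∎
  where open ≡-Reasoning

sum≡countᵇ+*countᵇ : ∀ {A : Set} (f : A → ℕ) (p q : A → Bool) (m : ℕ) xs →
  (∀ {x} → x ∈ xs → f x ≡ indicator (p x) + m * indicator (q x)) →
  sum (map f xs) ≡ countᵇ p xs + m * countᵇ q xs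
sum≡countᵇ+*countᵇ f p q m []       _  = cong (0 +_) (sym (*-zeroʳ m))
sum≡countᵇ+*countᵇ f p q m (x ∷ xs) fx = begin
  f x + sum (map f xs)
    ≡⟨ cong₂ _+_ (fx (here refl)) (sum≡countᵇ+*countᵇ f p q m xs (fx ∘ there)) ⟩
  (indicator (p x) + m * indicator (q x)) + (countᵇ p xs + m * countᵇ q xs)
    ≡⟨ regroup (indicator (p x)) (indicator (q x)) (countᵇ p xs) (countᵇ q xs) m ⟩
  (indicator (p x) + countᵇ p xs) + m * (indicator (q x) + countᵇ q xs)
    ≡⟨ cong₂ (λ a b → a + m * b) (countᵇ-∷ p x xs) (countᵇ-∷ q x xs) ⟨
  countᵇ p (x ∷ xs) + m * countᵇ q (x ∷ xs)
    ∎
  where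
  open ≡-Reasoning
  regroup : ∀ a b c d m → (a + m * b) + (c + m * d) ≡ (a + c) + m * (b + d)
  regroup = solve-∀

module _ (r : ℕ → Bool) where

  countᵇ-upTo-suc : ∀ n → countᵇ r (upTo (suc n)) ≡ countᵇ r (upTo n) + indicator (r n)
  countᵇ-upTo-suc n = begin
    countᵇ r (upTo (suc n))                ≡⟨ cong (countᵇ r) (upTo-∷ʳ n) ⟨
    countᵇ r (upTo n ++ n ∷ [])            ≡⟨ countᵇ-++ r (upTo n) (n ∷ []) ⟩
    countᵇ r (upTo n) + countᵇ r (n ∷ [])  ≡⟨ cong (countᵇ r (upTo n) +_) (trans (countᵇ-∷ r n []) (+-identityʳ _)) ⟩
    countᵇ r (upTo n) + indicator (r n)    ∎
    where open ≡-Reasoning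

  countᵇ-upTo-const : ∀ b n → (∀ j → j < n → r j ≡ b) → countᵇ r (upTo n) ≡ n * indicator b
  countᵇ-upTo-const b zero    _  = refl
  countᵇ-upTo-const b (suc n) rb = begin
    countᵇ r (upTo (suc n))                ≡⟨ countᵇ-upTo-suc n ⟩
    countᵇ r (upTo n) + indicator (r n)    ≡⟨ cong₂ _+_ (countᵇ-upTo-const b n (λ j j<n → rb j (m<n⇒m<1+n j<n))) (cong indicator (rb n ≤-refl)) ⟩
    n * indicator b + indicator b          ≡⟨ +-comm (n * indicator b) _ ⟩
    suc n * indicator b                    ∎
    where open ≡-Reasoning

  countᵇ-upTo-except : ∀ b n s → s ≤ n → (∀ j → j ≤ n → j ≢ s → r j ≡ b) →
                       countᵇ r (upTo (suc n)) ≡ indicator (r s) + n * indicator b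
  countᵇ-upTo-except b n s s≤n rb with m≤n⇒m<n∨m≡n s≤n
  ... | inj₂ refl = begin
    countᵇ r (upTo (suc n))                ≡⟨ countᵇ-upTo-suc n ⟩
    countᵇ r (upTo n) + indicator (r n)    ≡⟨ cong (_+ indicator (r n)) (countᵇ-upTo-const b n (λ j j<n → rb j (<⇒≤ j<n) (<⇒≢ j<n))) ⟩
    n * indicator b + indicator (r n)      ≡⟨ +-comm (n * indicator b) _ ⟩
    indicator (r n) + n * indicator b      ∎
    where open ≡-Reasoning
  countᵇ-upTo-except b (suc n) s s≤n rb | inj₁ s<1+n = begin
    countᵇ r (upTo (suc (suc n)))                        ≡⟨ countᵇ-upTo-suc (suc n) ⟩
    countᵇ r (upTo (suc n)) + indicator (r (suc n))      ≡⟨ cong₂ _+_ (countᵇ-upTo-except b n s (≤-pred s<1+n) (λ j j≤n → rb j (m≤n⇒m≤1+n j≤n)))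
                                                                      (cong indicator (rb (suc n) ≤-refl (≢-sym (<⇒≢ s<1+n)))) ⟩
    indicator (r s) + n * indicator b + indicator b      ≡⟨ +-assoc (indicator (r s)) _ _ ⟩
    indicator (r s) + (n * indicator b + indicator b)    ≡⟨ cong (indicator (r s) +_) (+-comm (n * indicator b) _) ⟩
    indicator (r s) + suc n * indicator b                ∎
    where open ≡-Reasoning

-- Left-to-right maxima and the statistic mmp

-- The left-to-right maxima of t ∷ xs, other than t itself.
recordsAbove : ℕ → List ℕ → ℕ
recordsAbove t []       = 0
recordsAbove t (b ∷ xs) = indicator (t <ᵇ b) + recordsAbove (t ⊔ b) xs

records : List ℕ → ℕ
records []       = 0
records (a ∷ xs) = suc (recordsAbove a xs)

-- mmpAux, with the prefix remembered only through its maximum t.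
mmpAfter : ℕ → List ℕ → ℕ
mmpAfter t []         = 0
mmpAfter t (a ∷ rest) = indicator (not (a <ᵇ t) ∧ rightCond a rest) + mmpAfter (t ⊔ a) rest

∨-<ᵇ : ∀ a b c → ((a <ᵇ b) ∨ (a <ᵇ c)) ≡ (a <ᵇ b ⊔ c)
∨-<ᵇ a b c with a <ᵇ b | <ᵇ-reflects-< a b | a <ᵇ c | <ᵇ-reflects-< a c
... | true  | ofʸ a<b | _     | _        = sym (<ᵇ-true (m<n⇒m<n⊔o c a<b))
... | false | _       | true  | ofʸ a<c  = sym (<ᵇ-true (m<n⇒m<o⊔n b a<c))
... | false | ofⁿ a≮b | false | ofⁿ a≮c = sym (<ᵇ-false (⊔-lub (≮⇒≥ a≮b) (≮⇒≥ a≮c)))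

any-<ᵇ : ∀ a xs → any (a <ᵇ_) xs ≡ (a <ᵇ maxList xs)
any-<ᵇ a []       = refl
any-<ᵇ a (b ∷ xs) = trans (cong ((a <ᵇ b) ∨_) (any-<ᵇ a xs)) (∨-<ᵇ a b (maxList xs))

maxList-∷ʳ : ∀ xs a → maxList (xs ∷ʳ a) ≡ maxList xs ⊔ a
maxList-∷ʳ []       a = ⊔-comm a 0
maxList-∷ʳ (b ∷ xs) a = trans (cong (b ⊔_) (maxList-∷ʳ xs a)) (sym (⊔-assoc b (maxList xs) a))

if-then-1-else-0 : ∀ b → (if b then 1 else 0) ≡ indicator b
if-then-1-else-0 true  = refl
if-then-1-else-0 false = refl

mmpAux≡mmpAfter : ∀ prefix σ → mmpAux prefix σ ≡ mmpAfter (maxList prefix) σ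
mmpAux≡mmpAfter prefix []         = refl
mmpAux≡mmpAfter prefix (a ∷ rest) = cong₂ _+_
  (trans (if-then-1-else-0 _) (cong (λ b → indicator (not b ∧ rightCond a rest)) (any-<ᵇ a prefix)))
  (trans (mmpAux≡mmpAfter (prefix ∷ʳ a) rest) (cong (λ t → mmpAfter t rest) (maxList-∷ʳ prefix a)))

recordsAbove-≥maxList : ∀ t xs → maxList xs ≤ t → recordsAbove t xs ≡ 0
recordsAbove-≥maxList t []       _   = refl
recordsAbove-≥maxList t (b ∷ xs) M≤t =
  cong₂ (λ c m → indicator c + m) (<ᵇ-false b≤t)
    (trans (cong (λ u → recordsAbove u xs) (m≥n⇒m⊔n≡m b≤t))
           (recordsAbove-≥maxList t xs (≤-trans (m≤n⊔m b (maxList xs)) M≤t)))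
  where b≤t = ≤-trans (m≤m⊔n b (maxList xs)) M≤t

recordsAbove-<maxList : ∀ t xs → t < maxList xs → 1 ≤ recordsAbove t xs
recordsAbove-<maxList t (b ∷ xs) t<M with t <ᵇ b | <ᵇ-reflects-< t b
... | true  | _        = s≤s z≤n
... | false | ofⁿ t≮b rewrite m≥n⇒m⊔n≡m (≮⇒≥ t≮b) =
  recordsAbove-<maxList t xs (≰⇒> (λ M≤t → <⇒≱ t<M (⊔-lub (≮⇒≥ t≮b) M≤t)))

maxList-∈ : ∀ x xs → maxList (x ∷ xs) ∈ x ∷ xs
maxList-∈ x []       = here (⊔-identityʳ x)
maxList-∈ x (y ∷ xs) with ≤-total (maxList (y ∷ xs)) x
... | inj₁ M≤x = here (m≥n⇒m⊔n≡m M≤x)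
... | inj₂ x≤M = there (subst (_∈ y ∷ xs) (sym (m≤n⇒m⊔n≡n x≤M)) (maxList-∈ y xs))

upToValue-head : ∀ x xs → upToValue x (x ∷ xs) ≡ x ∷ []
upToValue-head x xs rewrite ≡ᵇ-true {x} refl = refl

upToValue-∷ : ∀ m x xs → x ≢ m → upToValue m (x ∷ xs) ≡ x ∷ upToValue m xs
upToValue-∷ m x xs x≢m rewrite ≡ᵇ-false x≢m = refl

countᵇ-<ᵇ-upToValue : ∀ t m xs → m ∈ xs → t < m → 1 ≤ countᵇ (t <ᵇ_) (upToValue m xs)
countᵇ-<ᵇ-upToValue t m (x ∷ xs) m∈ t<m with x ≡ᵇ m | ≡ᵇ-reflects-≡ x m | m∈
... | true  | ofʸ refl | _        rewrite <ᵇ-true t<m = s≤s z≤n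
... | false | ofⁿ x≢m  | here m≡x = contradiction (sym m≡x) x≢m
... | false | ofⁿ x≢m  | there m∈xs =
  subst (1 ≤_) (sym (countᵇ-∷ (t <ᵇ_) x (upToValue m xs)))
    (≤-trans (countᵇ-<ᵇ-upToValue t m xs m∈xs t<m) (m≤n+m _ (indicator (t <ᵇ x))))

exceedingBeforeMax : ℕ → List ℕ → ℕ
exceedingBeforeMax t xs = countᵇ (t <ᵇ_) (upToValue (maxList xs) xs)

exceedingBeforeMax-head : ∀ t x xs → maxList xs ≤ x → exceedingBeforeMax t (x ∷ xs) ≡ indicator (t <ᵇ x) + 0
exceedingBeforeMax-head t x xs M≤x = begin
  countᵇ (t <ᵇ_) (upToValue (x ⊔ maxList xs) (x ∷ xs)) ≡⟨ cong (λ m → countᵇ (t <ᵇ_) (upToValue m (x ∷ xs))) (m≥n⇒m⊔n≡m M≤x) ⟩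
  countᵇ (t <ᵇ_) (upToValue x (x ∷ xs))               ≡⟨ cong (countᵇ (t <ᵇ_)) (upToValue-head x xs) ⟩
  countᵇ (t <ᵇ_) (x ∷ [])                              ≡⟨ countᵇ-∷ (t <ᵇ_) x [] ⟩
  indicator (t <ᵇ x) + 0                               ∎
  where open ≡-Reasoning

exceedingBeforeMax-∷ : ∀ t x xs → x < maxList xs →
                       exceedingBeforeMax t (x ∷ xs) ≡ indicator (t <ᵇ x) + exceedingBeforeMax t xs
exceedingBeforeMax-∷ t x xs x<M = begin
  countᵇ (t <ᵇ_) (upToValue (x ⊔ maxList xs) (x ∷ xs)) ≡⟨ cong (λ m → countᵇ (t <ᵇ_) (upToValue m (x ∷ xs))) (m≤n⇒m⊔n≡n (<⇒≤ x<M)) ⟩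
  countᵇ (t <ᵇ_) (upToValue (maxList xs) (x ∷ xs))     ≡⟨ cong (countᵇ (t <ᵇ_)) (upToValue-∷ (maxList xs) x xs (<⇒≢ x<M)) ⟩
  countᵇ (t <ᵇ_) (x ∷ upToValue (maxList xs) xs)       ≡⟨ countᵇ-∷ (t <ᵇ_) x _ ⟩
  indicator (t <ᵇ x) + exceedingBeforeMax t xs         ∎
  where open ≡-Reasoning

exceedingBeforeMax-<maxList : ∀ t xs → t < maxList xs → 1 ≤ exceedingBeforeMax t xs
exceedingBeforeMax-<maxList t (x ∷ xs) t<M = countᵇ-<ᵇ-upToValue t _ (x ∷ xs) (maxList-∈ x xs) t<M

-- Each is positive iff t < maxList xs; past the first entry x exceeding t, both are then
-- at least 2 iff x < maxList xs.
2≤exceedingBeforeMax≡2≤recordsAbove : ∀ t xs → (2 ≤ᵇ exceedingBeforeMax t xs) ≡ (2 ≤ᵇ recordsAbove t xs)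
2≤exceedingBeforeMax≡2≤recordsAbove t []       = refl
2≤exceedingBeforeMax≡2≤recordsAbove t (x ∷ xs) with maxList xs ≤? x
... | yes M≤x = cong (2 ≤ᵇ_) (trans (exceedingBeforeMax-head t x xs M≤x)
                  (cong (indicator (t <ᵇ x) +_) (sym (recordsAbove-≥maxList (t ⊔ x) xs (≤-trans M≤x (m≤n⊔m t x))))))
... | no M≰x rewrite exceedingBeforeMax-∷ t x xs (≰⇒> M≰x) with t <ᵇ x | <ᵇ-reflects-< t x
...   | true  | ofʸ t<x rewrite m≤n⇒m⊔n≡n (<⇒≤ t<x) =
  trans (2≤ᵇsuc (exceedingBeforeMax-<maxList t xs (<-trans t<x (≰⇒> M≰x))))
        (sym (2≤ᵇsuc (recordsAbove-<maxList x xs (≰⇒> M≰x))))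
  where
  2≤ᵇsuc : ∀ {m} → 1 ≤ m → (2 ≤ᵇ suc m) ≡ true
  2≤ᵇsuc (s≤s _) = refl
...   | false | ofⁿ t≮x rewrite m≥n⇒m⊔n≡m (≮⇒≥ t≮x) = 2≤exceedingBeforeMax≡2≤recordsAbove t xs

rightCond≡2≤recordsAbove : ∀ a rest → rightCond a rest ≡ (2 ≤ᵇ recordsAbove a rest)
rightCond≡2≤recordsAbove a []       = refl
rightCond≡2≤recordsAbove a (x ∷ xs) = 2≤exceedingBeforeMax≡2≤recordsAbove a (x ∷ xs)

indicator-2≤+∸2 : ∀ r → indicator (2 ≤ᵇ r) + (r ∸ 2) ≡ suc r ∸ 2
indicator-2≤+∸2 zero          = refl
indicator-2≤+∸2 (suc zero)    = refl
indicator-2≤+∸2 (suc (suc r)) = refl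

-- Freshness of t matters: an entry equal to the running maximum would count as a match.
mutual
  mmpAfter≡recordsAbove∸2 : ∀ t σ → any (t ≡ᵇ_) σ ≡ false → T (distinct σ) →
                            mmpAfter t σ ≡ recordsAbove t σ ∸ 2
  mmpAfter≡recordsAbove∸2 t []       _    _ = refl
  mmpAfter≡recordsAbove∸2 t (b ∷ rs) t∉ d with t <ᵇ b | <ᵇ-reflects-< t b
  ... | true  | ofʸ t<b rewrite <ᵇ-false (<⇒≤ t<b) | m≤n⇒m⊔n≡n (<⇒≤ t<b) = mmpAfter-record b rs d
  ... | false | ofⁿ t≮b with b<t ← ≤∧≢⇒< (≮⇒≥ t≮b) (≢-sym (≡ᵇ-false⇒≢ (∨-conicalˡ _ _ t∉)))
    rewrite <ᵇ-true b<t | m≥n⇒m⊔n≡m (<⇒≤ b<t) =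
    mmpAfter≡recordsAbove∸2 t rs (∨-conicalʳ _ _ t∉) (proj₂ (Equivalence.to T-∧ d))

  mmpAfter-record : ∀ b rs → T (distinct (b ∷ rs)) →
                    indicator (rightCond b rs) + mmpAfter b rs ≡ suc (recordsAbove b rs) ∸ 2
  mmpAfter-record b rs d with Equivalence.to T-∧ d
  ... | b∉ , d′ rewrite rightCond≡2≤recordsAbove b rs
                      | mmpAfter≡recordsAbove∸2 b rs (Equivalence.to T-not-≡ b∉) d′ =
    indicator-2≤+∸2 (recordsAbove b rs)

mmp≡records∸2 : ∀ σ → T (distinct σ) → mmp σ ≡ records σ ∸ 2
mmp≡records∸2 []       _ = refl
mmp≡records∸2 (a ∷ rest) d = trans (mmpAux≡mmpAfter [] (a ∷ rest)) (mmpAfter-record a rest d)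

record IsPerm (n : ℕ) (σ : List ℕ) : Set where
  field
    length≡         : length σ ≡ n
    apply-<         : ∀ {p} → p < n → apply σ p < n
    apply-injective : ∀ {p q} → p < n → q < n → apply σ p ≡ apply σ q → p ≡ q

open IsPerm

apply-ext : ∀ xs ys → length xs ≡ length ys → (∀ {p} → p < length xs → apply xs p ≡ apply ys p) → xs ≡ ys
apply-ext []       []       _   _  = refl
apply-ext (x ∷ xs) (y ∷ ys) len eq =
  cong₂ _∷_ (eq (s≤s z≤n)) (apply-ext xs ys (suc-injective len) (eq ∘ s≤s))

apply-applyUpTo : ∀ f {n p} → p < n → apply (applyUpTo f n) p ≡ f p
apply-applyUpTo f {suc n} {zero}  _         = refl
apply-applyUpTo f {suc n} {suc p} (s≤s p<n) = apply-applyUpTo (f ∘ suc) p<n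

applyUpTo-IsPerm : ∀ f n → (∀ {p} → p < n → f p < n) →
                   (∀ {p q} → p < n → q < n → f p ≡ f q → p ≡ q) → IsPerm n (applyUpTo f n)
applyUpTo-IsPerm f n f< f-inj = record
  { length≡         = length-applyUpTo f n
  ; apply-<         = λ p<n → subst (_< n) (sym (apply-applyUpTo f p<n)) (f< p<n)
  ; apply-injective = λ p<n q<n eq → f-inj p<n q<n
      (trans (sym (apply-applyUpTo f p<n)) (trans eq (apply-applyUpTo f q<n)))
  }

concatMap-map≡cartesianProductWith : ∀ {A B C : Set} (f : A → B → C) xs ys →
  concatMap (λ a → map (f a) ys) xs ≡ cartesianProductWith f xs ys
concatMap-map≡cartesianProductWith f []       ys = refl
concatMap-map≡cartesianProductWith f (x ∷ xs) ys = cong (map (f x) ys ++_) (concatMap-map≡cartesianProductWith f xs ys)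

words-suc : ∀ n k → words n (suc k) ≡ cartesianProductWith _∷_ (upTo n) (words n k)
words-suc n k = concatMap-map≡cartesianProductWith _∷_ (upTo n) (words n k)

words-Unique : ∀ n k → Unique (words n k)
words-Unique n zero    = All.[] AllPairs.∷ AllPairs.[]
words-Unique n (suc k) = subst Unique (sym (words-suc n k))
  (cartesianProductWith⁺ _∷_ ∷-injective (upTo⁺ n) (words-Unique n k))

∈words⇒ : ∀ n k {σ} → σ ∈ words n k → length σ ≡ k × (∀ {p} → p < k → apply σ p < n)
∈words⇒ n zero    (here refl) = refl , λ ()
∈words⇒ n (suc k) σ∈ with ∈-cartesianProductWith⁻ _∷_ (upTo n) (words n k) (subst (_ ∈_) (words-suc n k) σ∈)
... | a , τ , a∈ , τ∈ , refl with ∈words⇒ n k τ∈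
...   | len , τ< = cong suc len , λ { {zero} _ → ∈-upTo⁻ a∈ ; {suc p} (s≤s p<k) → τ< p<k }

∈words⇐ : ∀ n k σ → length σ ≡ k → (∀ {p} → p < k → apply σ p < n) → σ ∈ words n k
∈words⇐ n zero    []      _   _  = here refl
∈words⇐ n (suc k) (a ∷ τ) len σ< = subst (a ∷ τ ∈_) (sym (words-suc n k))
  (∈-cartesianProductWith⁺ _∷_ (∈-upTo⁺ (σ< (s≤s z≤n))) (∈words⇐ n k τ (suc-injective len) (σ< ∘ s≤s)))

any-≡ᵇ-false⇒ : ∀ a xs → any (a ≡ᵇ_) xs ≡ false → ∀ {p} → p < length xs → apply xs p ≢ a
any-≡ᵇ-false⇒ a (x ∷ xs) a∉ {zero}  _         = ≢-sym (≡ᵇ-false⇒≢ (∨-conicalˡ _ _ a∉))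
any-≡ᵇ-false⇒ a (x ∷ xs) a∉ {suc p} (s≤s p<n) = any-≡ᵇ-false⇒ a xs (∨-conicalʳ _ _ a∉) p<n

any-≡ᵇ-false⇐ : ∀ a xs → (∀ {p} → p < length xs → apply xs p ≢ a) → any (a ≡ᵇ_) xs ≡ false
any-≡ᵇ-false⇐ a []       _   = refl
any-≡ᵇ-false⇐ a (x ∷ xs) a∉ rewrite ≡ᵇ-false {a} {x} (≢-sym (a∉ (s≤s z≤n))) = any-≡ᵇ-false⇐ a xs (a∉ ∘ s≤s)

distinct⇒apply-injective : ∀ σ → T (distinct σ) →
  ∀ {p q} → p < length σ → q < length σ → apply σ p ≡ apply σ q → p ≡ q
distinct⇒apply-injective (a ∷ xs) d {zero}  {zero}  _          _          _  = refl
distinct⇒apply-injective (a ∷ xs) d {zero}  {suc q} _          (s≤s q<n) eq =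
  contradiction (sym eq) (any-≡ᵇ-false⇒ a xs (Equivalence.to T-not-≡ (proj₁ (Equivalence.to T-∧ d))) q<n)
distinct⇒apply-injective (a ∷ xs) d {suc p} {zero}  (s≤s p<n) _          eq =
  contradiction eq (any-≡ᵇ-false⇒ a xs (Equivalence.to T-not-≡ (proj₁ (Equivalence.to T-∧ d))) p<n)
distinct⇒apply-injective (a ∷ xs) d {suc p} {suc q} (s≤s p<n) (s≤s q<n) eq =
  cong suc (distinct⇒apply-injective xs (proj₂ (Equivalence.to T-∧ d)) p<n q<n eq)

apply-injective⇒distinct : ∀ σ → (∀ {p q} → p < length σ → q < length σ → apply σ p ≡ apply σ q → p ≡ q) →
                           T (distinct σ)
apply-injective⇒distinct []       _     = _
apply-injective⇒distinct (a ∷ xs) σ-inj = Equivalence.from T-∧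
  ( Equivalence.from T-not-≡ (any-≡ᵇ-false⇐ a xs (λ p<n eq → 0≢1+n (σ-inj (s≤s z≤n) (s≤s p<n) (sym eq))))
  , apply-injective⇒distinct xs (λ p<n q<n eq → suc-injective (σ-inj (s≤s p<n) (s≤s q<n) eq)) )

∈perms⇒distinct : ∀ n {σ} → σ ∈ perms n → T (distinct σ)
∈perms⇒distinct n σ∈ = proj₂ (∈-filter⁻ (T? ∘ distinct) {xs = words n n} σ∈)

∈perms⇒IsPerm : ∀ n {σ} → σ ∈ perms n → IsPerm n σ
∈perms⇒IsPerm n {σ} σ∈ with ∈-filter⁻ (T? ∘ distinct) σ∈
... | σ∈words , d with ∈words⇒ n n σ∈words
...   | len , σ< = record
  { length≡         = len
  ; apply-<         = σ<
  ; apply-injective = λ p<n q<n → distinct⇒apply-injective σ d (subst (_ <_) (sym len) p<n) (subst (_ <_) (sym len) q<n)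
  }

IsPerm⇒∈perms : ∀ n {σ} → IsPerm n σ → σ ∈ perms n
IsPerm⇒∈perms n {σ} P = ∈-filter⁺ (T? ∘ distinct) (∈words⇐ n n σ (length≡ P) (apply-< P))
  (apply-injective⇒distinct σ (λ p<n q<n → apply-injective P (subst (_ <_) (length≡ P) p<n) (subst (_ <_) (length≡ P) q<n)))

perms-Unique : ∀ n → Unique (perms n)
perms-Unique n = filter⁺ (T? ∘ distinct) (words-Unique n n)

pigeonhole-ℕ : ∀ m (f : ℕ → ℕ) → (∀ {k} → k ≤ m → f k < m) → ∃₂ λ a b → a < b × b ≤ m × f a ≡ f b
pigeonhole-ℕ m f f< with Fin.pigeonhole (n<1+n m) (λ i → Fin.fromℕ< (f< (toℕ≤m i)))
  where toℕ≤m = λ (i : Fin.Fin (suc m)) → ≤-pred (Fin.toℕ<n i)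
... | i , j , i<j , eq = Fin.toℕ i , Fin.toℕ j , i<j , ≤-pred (Fin.toℕ<n j) ,
  trans (sym (Fin.toℕ-fromℕ< _)) (trans (cong Fin.toℕ eq) (Fin.toℕ-fromℕ< _))

-- Pigeonhole applied to f extended by f m := v.
IsPerm-surjective : ∀ {m σ} → IsPerm m σ → ∀ {v} → v < m → ∃ λ p → p < m × apply σ p ≡ v
IsPerm-surjective {m} {σ} P {v} v<m with pigeonhole-ℕ m f f<
  where
  f : ℕ → ℕ
  f k = if k ≡ᵇ m then v else apply σ k
  f< : ∀ {k} → k ≤ m → f k < m
  f< {k} k≤m with k ≡ᵇ m | ≡ᵇ-reflects-≡ k m
  ... | true  | _       = v<m
  ... | false | ofⁿ k≢m = apply-< P (≤∧≢⇒< k≤m k≢m)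
... | a , b , a<b , b≤m , eq with m≤n⇒m<n∨m≡n b≤m
...   | inj₂ refl rewrite ≡ᵇ-true {m} refl | ≡ᵇ-false (<⇒≢ a<b) = a , a<b , eq
...   | inj₁ b<m  rewrite ≡ᵇ-false (<⇒≢ b<m) | ≡ᵇ-false (<⇒≢ (<-trans a<b b<m)) =
  contradiction (apply-injective P (<-trans a<b b<m) b<m eq) (<⇒≢ a<b)

-- Distributions satisfying the Stirling recursion

countᵇ-sameElements : ∀ {A : Set} {xs ys : List A} → Unique xs → Unique ys →
  (∀ {x} → x ∈ xs → x ∈ ys) → (∀ {x} → x ∈ ys → x ∈ xs) → ∀ p → countᵇ p xs ≡ countᵇ p ys
countᵇ-sameElements xs! ys! xs⊆ys ys⊆xs p =
  ↭-length (filter-↭ (T? ∘ p) (∼bag⇒↭ (unique∧set⇒bag xs! ys! (mk⇔ xs⊆ys ys⊆xs))))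

Unique-map⁺ : ∀ {A B : Set} (f : A → B) {xs} → Unique xs →
  (∀ {x y} → x ∈ xs → y ∈ xs → f x ≡ f y → x ≡ y) → Unique (map f xs)
Unique-map⁺ f {[]}     _                f-inj = AllPairs.[]
Unique-map⁺ f {x ∷ xs} (x∉ AllPairs.∷ xs!) f-inj =
  fresh xs x∉ (λ y∈ → f-inj (here refl) (there y∈)) AllPairs.∷
  Unique-map⁺ f xs! (λ x∈ y∈ → f-inj (there x∈) (there y∈))
  where
  fresh : ∀ ys → All.All (x ≢_) ys → (∀ {y} → y ∈ ys → f x ≡ f y → x ≡ y) → All.All (f x ≢_) (map f ys)
  fresh []       All.[]          _     = All.[]
  fresh (y ∷ ys) (x≢y All.∷ x∉) f-inj = (x≢y ∘ f-inj (here refl)) All.∷ fresh ys x∉ (f-inj ∘ there)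

distribution : (ℕ → List ℕ → ℕ) → ℕ → ℕ → ℕ
distribution stat n k = countᵇ (λ σ → stat n σ ≡ᵇ k) (perms n)

-- A combinatorial derivation of the recursion c(n+1,k) = c(n,k-1) + n c(n,k) for the
-- distribution of stat.
record Insertion (stat : ℕ → List ℕ → ℕ) : Set where
  field
    insert            : ℕ → List ℕ → ℕ → List ℕ
    insert-IsPerm     : ∀ {n τ j} → IsPerm n τ → j ≤ n → IsPerm (suc n) (insert n τ j)
    insert-injective  : ∀ {n τ τ′ j j′} → IsPerm n τ → IsPerm n τ′ → j ≤ n → j′ ≤ n →
                        insert n τ j ≡ insert n τ′ j′ → τ ≡ τ′ × j ≡ j′
    insert-surjective : ∀ {n σ} → IsPerm (suc n) σ → ∃₂ λ τ j → IsPerm n τ × j ≤ n × insert n τ j ≡ σ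
    newSlot           : ℕ → ℕ
    newSlot≤          : ∀ n → newSlot n ≤ n
    stat-newSlot      : ∀ {n τ} → IsPerm n τ → stat (suc n) (insert n τ (newSlot n)) ≡ suc (stat n τ)
    stat-insert       : ∀ {n τ j} → IsPerm n τ → j ≤ n → j ≢ newSlot n → stat (suc n) (insert n τ j) ≡ stat n τ

module _ {stat : ℕ → List ℕ → ℕ} (I : Insertion stat) (n : ℕ) where
  open Insertion I

  private
    slots : List (List ℕ × ℕ)
    slots = cartesianProduct (perms n) (upTo (suc n))

    insertSlot : List ℕ × ℕ → List ℕ
    insertSlot (τ , j) = insert n τ j

    ∈slots⇒ : ∀ {τ j} → (τ , j) ∈ slots → IsPerm n τ × j ≤ n
    ∈slots⇒ τj∈ with ∈-cartesianProduct⁻ (perms n) (upTo (suc n)) τj∈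
    ... | τ∈ , j∈ = ∈perms⇒IsPerm n τ∈ , ≤-pred (∈-upTo⁻ j∈)

    extensions : List (List ℕ)
    extensions = map insertSlot slots

    extensions-Unique : Unique extensions
    extensions-Unique = Unique-map⁺ insertSlot (cartesianProduct⁺ (perms-Unique n) (upTo⁺ (suc n))) inj
      where
      inj : ∀ {x y} → x ∈ slots → y ∈ slots → insertSlot x ≡ insertSlot y → x ≡ y
      inj {τ , j} {τ′ , j′} x∈ y∈ eq with ∈slots⇒ x∈ | ∈slots⇒ y∈
      ... | P , j≤n | P′ , j′≤n with insert-injective P P′ j≤n j′≤n eq
      ...   | refl , refl = refl

    ∈extensions⇒ : ∀ {σ} → σ ∈ extensions → σ ∈ perms (suc n)
    ∈extensions⇒ σ∈ with ∈-map⁻ insertSlot σ∈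
    ... | (τ , j) , τj∈ , refl = IsPerm⇒∈perms (suc n) (insert-IsPerm (proj₁ (∈slots⇒ τj∈)) (proj₂ (∈slots⇒ τj∈)))

    ∈extensions⇐ : ∀ {σ} → σ ∈ perms (suc n) → σ ∈ extensions
    ∈extensions⇐ σ∈ with insert-surjective (∈perms⇒IsPerm (suc n) σ∈)
    ... | τ , j , P , j≤n , refl =
      ∈-map⁺ insertSlot (∈-cartesianProduct⁺ (IsPerm⇒∈perms n P) (∈-upTo⁺ (s≤s j≤n)))

    countᵇ-slots : ∀ k {τ} → τ ∈ perms n → countᵇ (λ j → stat (suc n) (insert n τ j) ≡ᵇ k) (upTo (suc n))
                   ≡ indicator (suc (stat n τ) ≡ᵇ k) + n * indicator (stat n τ ≡ᵇ k)
    countᵇ-slots k {τ} τ∈ = trans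
      (countᵇ-upTo-except _ (stat n τ ≡ᵇ k) n (newSlot n) (newSlot≤ n)
        (λ j j≤n j≢ → cong (_≡ᵇ k) (stat-insert P j≤n j≢)))
      (cong (λ b → indicator b + n * indicator (stat n τ ≡ᵇ k)) (cong (_≡ᵇ k) (stat-newSlot P)))
      where P = ∈perms⇒IsPerm n τ∈

  distribution-suc : ∀ k → distribution stat (suc n) k ≡
                     countᵇ (λ τ → suc (stat n τ) ≡ᵇ k) (perms n) + n * distribution stat n k
  distribution-suc k = begin
    countᵇ has-k (perms (suc n))
      ≡⟨ countᵇ-sameElements (perms-Unique (suc n)) extensions-Unique ∈extensions⇐ ∈extensions⇒ has-k ⟩
    countᵇ has-k (map insertSlot slots)
      ≡⟨ countᵇ-map has-k insertSlot slots ⟩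
    countᵇ (has-k ∘ insertSlot) slots
      ≡⟨ countᵇ-cartesianProduct (has-k ∘ insertSlot) (perms n) (upTo (suc n)) ⟩
    sum (map (λ τ → countᵇ (λ j → has-k (insert n τ j)) (upTo (suc n))) (perms n))
      ≡⟨ sum≡countᵇ+*countᵇ _ (λ τ → suc (stat n τ) ≡ᵇ k) (λ τ → stat n τ ≡ᵇ k) n (perms n) (countᵇ-slots k) ⟩
    countᵇ (λ τ → suc (stat n τ) ≡ᵇ k) (perms n) + n * distribution stat n k
      ∎
    where
    open ≡-Reasoning
    has-k : List ℕ → Bool
    has-k σ = stat (suc n) σ ≡ᵇ k

distribution-unique : ∀ {stat stat′} → Insertion stat → Insertion stat′ → stat 0 [] ≡ stat′ 0 [] →
                      ∀ n k → distribution stat n k ≡ distribution stat′ n k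
-- perms 0 reduces to [] ∷ [].
distribution-unique {stat} {stat′} I I′ base zero k =
  trans (countᵇ-∷ (λ σ → stat 0 σ ≡ᵇ k) [] [])
    (trans (cong (λ r → indicator (r ≡ᵇ k) + 0) base) (sym (countᵇ-∷ (λ σ → stat′ 0 σ ≡ᵇ k) [] [])))
distribution-unique {stat} {stat′} I I′ base (suc n) zero = begin
  distribution stat (suc n) 0                                    ≡⟨ distribution-suc I n 0 ⟩
  countᵇ (λ _ → false) (perms n) + n * distribution stat n 0     ≡⟨ cong₂ (λ a b → a + n * b) (countᵇ-false (perms n)) (distribution-unique I I′ base n 0) ⟩
  0 + n * distribution stat′ n 0                                 ≡⟨ cong (_+ n * distribution stat′ n 0) (countᵇ-false (perms n)) ⟨
  countᵇ (λ _ → false) (perms n) + n * distribution stat′ n 0    ≡⟨ distribution-suc I′ n 0 ⟨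
  distribution stat′ (suc n) 0                                   ∎
  where open ≡-Reasoning
distribution-unique {stat} {stat′} I I′ base (suc n) (suc k) = begin
  distribution stat (suc n) (suc k)                              ≡⟨ distribution-suc I n (suc k) ⟩
  distribution stat n k + n * distribution stat n (suc k)        ≡⟨ cong₂ (λ a b → a + n * b) (distribution-unique I I′ base n k)
                                                                                              (distribution-unique I I′ base n (suc k)) ⟩
  distribution stat′ n k + n * distribution stat′ n (suc k)      ≡⟨ distribution-suc I′ n (suc k) ⟨
  distribution stat′ (suc n) (suc k)                             ∎
  where open ≡-Reasoning

-- Records: inserting a new minimum

-- ℕ analogues of Data.Fin's punchIn and punchOut.
punchIn : ℕ → ℕ → ℕ
punchIn j p = if p <ᵇ j then p else suc p

punchOut : ℕ → ℕ → ℕ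
punchOut j p = if p <ᵇ j then p else pred p

punchIn≢ : ∀ j p → punchIn j p ≢ j
punchIn≢ j p with p <ᵇ j | <ᵇ-reflects-< p j
... | true  | ofʸ p<j = <⇒≢ p<j
... | false | ofⁿ p≮j = ≢-sym (<⇒≢ (s≤s (≮⇒≥ p≮j)))

punchOut-punchIn : ∀ j p → punchOut j (punchIn j p) ≡ p
punchOut-punchIn j p with p <ᵇ j in p<ᵇj | <ᵇ-reflects-< p j
... | true  | _        rewrite p<ᵇj = refl
... | false | ofⁿ p≮j rewrite <ᵇ-false {suc p} {j} (m≤n⇒m≤1+n (≮⇒≥ p≮j)) = refl

punchIn-punchOut : ∀ {j p} → p ≢ j → punchIn j (punchOut j p) ≡ p
punchIn-punchOut {j} {p} p≢j with p <ᵇ j in p<ᵇj | <ᵇ-reflects-< p j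
... | true  | _        rewrite p<ᵇj = refl
... | false | ofⁿ p≮j with p
...   | zero   = contradiction (sym (n≤0⇒n≡0 (≮⇒≥ p≮j))) p≢j
...   | suc p′ rewrite <ᵇ-false {p′} {j} (≤-pred (≤∧≢⇒< (≮⇒≥ p≮j) (≢-sym p≢j))) = refl

punchIn-< : ∀ j {n p} → p < n → punchIn j p < suc n
punchIn-< j {p = p} p<n with p <ᵇ j
... | true  = m<n⇒m<1+n p<n
... | false = s≤s p<n

punchOut-< : ∀ {j n p} → j ≤ n → p < suc n → p ≢ j → punchOut j p < n
punchOut-< {j} {n} {p} j≤n p<1+n p≢j with p <ᵇ j | <ᵇ-reflects-< p j
... | true  | ofʸ p<j = <-≤-trans p<j j≤n
... | false | ofⁿ p≮j with p
...   | zero   = contradiction (sym (n≤0⇒n≡0 (≮⇒≥ p≮j))) p≢j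
...   | suc p′ = ≤-pred p<1+n

-- Inserting 0 at position j (at the end if j exceeds the length).
insertZeroAt : ℕ → List ℕ → List ℕ
insertZeroAt zero    xs       = 0 ∷ xs
insertZeroAt (suc j) []       = 0 ∷ []
insertZeroAt (suc j) (x ∷ xs) = x ∷ insertZeroAt j xs

length-insertZeroAt : ∀ j xs → length (insertZeroAt j xs) ≡ suc (length xs)
length-insertZeroAt zero    xs       = refl
length-insertZeroAt (suc j) []       = refl
length-insertZeroAt (suc j) (x ∷ xs) = cong suc (length-insertZeroAt j xs)

apply-insertZeroAt-at : ∀ j xs → apply (insertZeroAt j xs) j ≡ 0
apply-insertZeroAt-at zero    xs       = refl
apply-insertZeroAt-at (suc j) []       = refl
apply-insertZeroAt-at (suc j) (x ∷ xs) = apply-insertZeroAt-at j xs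

apply-insertZeroAt-punchIn : ∀ j xs p → apply (insertZeroAt j xs) (punchIn j p) ≡ apply xs p
apply-insertZeroAt-punchIn zero    xs       p       = refl
apply-insertZeroAt-punchIn (suc j) []       zero    = refl
apply-insertZeroAt-punchIn (suc j) []       (suc p) with p <ᵇ j
... | true  = refl
... | false = refl
apply-insertZeroAt-punchIn (suc j) (x ∷ xs) zero    = refl
apply-insertZeroAt-punchIn (suc j) (x ∷ xs) (suc p) with p <ᵇ j | apply-insertZeroAt-punchIn j xs p
... | true  | eq = eq
... | false | eq = eq

apply-map-suc : ∀ xs {p} → p < length xs → apply (map suc xs) p ≡ suc (apply xs p)
apply-map-suc (x ∷ xs) {zero}  _         = refl
apply-map-suc (x ∷ xs) {suc p} (s≤s p<n) = apply-map-suc xs p<n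

insertMin : List ℕ → ℕ → List ℕ
insertMin τ j = insertZeroAt j (map suc τ)

module _ {n τ} (P : IsPerm n τ) where

  length-insertMin : ∀ j → length (insertMin τ j) ≡ suc n
  length-insertMin j = trans (length-insertZeroAt j (map suc τ)) (cong suc (trans (length-map suc τ) (length≡ P)))

  apply-insertMin-punchIn : ∀ j {p} → p < n → apply (insertMin τ j) (punchIn j p) ≡ suc (apply τ p)
  apply-insertMin-punchIn j p<n =
    trans (apply-insertZeroAt-punchIn j (map suc τ) _) (apply-map-suc τ (subst (_ <_) (sym (length≡ P)) p<n))

  apply-insertMin-≢ : ∀ {j p} → j ≤ n → p < suc n → p ≢ j →
                      apply (insertMin τ j) p ≡ suc (apply τ (punchOut j p))
  apply-insertMin-≢ {j} j≤n p<1+n p≢j =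
    trans (cong (apply (insertMin τ j)) (sym (punchIn-punchOut p≢j))) (apply-insertMin-punchIn j (punchOut-< j≤n p<1+n p≢j))

  insertMin-IsPerm : ∀ {j} → j ≤ n → IsPerm (suc n) (insertMin τ j)
  insertMin-IsPerm {j} j≤n = record
    { length≡         = length-insertMin j
    ; apply-<         = bound
    ; apply-injective = injective
    }
    where
    σ = insertMin τ j
    bound : ∀ {p} → p < suc n → apply σ p < suc n
    bound {p} p<1+n with p ≟ j
    ... | yes refl = subst (_< suc n) (sym (apply-insertZeroAt-at p (map suc τ))) z<s
    ... | no p≢j   = subst (_< suc n) (sym (apply-insertMin-≢ j≤n p<1+n p≢j)) (s≤s (apply-< P (punchOut-< j≤n p<1+n p≢j)))
    apply≢apply-j : ∀ {p} → p < suc n → p ≢ j → apply σ p ≢ apply σ j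
    apply≢apply-j p<1+n p≢j eq = 0≢1+n (trans (sym (trans eq (apply-insertZeroAt-at j (map suc τ)))) (apply-insertMin-≢ j≤n p<1+n p≢j))
    injective : ∀ {p q} → p < suc n → q < suc n → apply σ p ≡ apply σ q → p ≡ q
    injective {p} {q} p<1+n q<1+n eq with p ≟ j | q ≟ j
    ... | yes p≡j | yes q≡j = trans p≡j (sym q≡j)
    ... | yes refl | no q≢j = contradiction (sym eq) (apply≢apply-j q<1+n q≢j)
    ... | no p≢j | yes refl = contradiction eq (apply≢apply-j p<1+n p≢j)
    ... | no p≢j | no q≢j = begin
      p                            ≡⟨ punchIn-punchOut p≢j ⟨
      punchIn j (punchOut j p)     ≡⟨ cong (punchIn j) (apply-injective P (punchOut-< j≤n p<1+n p≢j) (punchOut-< j≤n q<1+n q≢j)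
                                        (suc-injective (trans (sym (apply-insertMin-≢ j≤n p<1+n p≢j))
                                                        (trans eq (apply-insertMin-≢ j≤n q<1+n q≢j))))) ⟩
      punchIn j (punchOut j q)     ≡⟨ punchIn-punchOut q≢j ⟩
      q                            ∎
      where open ≡-Reasoning

insertMin-injective : ∀ {n τ τ′ j j′} → IsPerm n τ → IsPerm n τ′ → j ≤ n → j′ ≤ n →
                      insertMin τ j ≡ insertMin τ′ j′ → τ ≡ τ′ × j ≡ j′
insertMin-injective {n} {τ} {τ′} {j} {j′} P P′ j≤n j′≤n eq
  with refl ← apply-injective (insertMin-IsPerm P j≤n) (s≤s j≤n) (s≤s j′≤n)
                (trans (apply-insertZeroAt-at j (map suc τ))
                  (sym (trans (cong (λ σ → apply σ j′) eq) (apply-insertZeroAt-at j′ (map suc τ′)))))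
  = apply-ext τ τ′ (trans (length≡ P) (sym (length≡ P′))) same , refl
  where
  same : ∀ {p} → p < length τ → apply τ p ≡ apply τ′ p
  same {p} p<len = suc-injective (begin
    suc (apply τ p)                        ≡⟨ apply-insertMin-punchIn P j p<n ⟨
    apply (insertMin τ j) (punchIn j p)    ≡⟨ cong (λ σ → apply σ (punchIn j p)) eq ⟩
    apply (insertMin τ′ j) (punchIn j p)   ≡⟨ apply-insertMin-punchIn P′ j p<n ⟩
    suc (apply τ′ p)                       ∎)
    where
    open ≡-Reasoning
    p<n = subst (p <_) (length≡ P) p<len

-- τ is read off σ by deleting the 0 and shifting the remaining values down.
insertMin-surjective : ∀ {n σ} → IsPerm (suc n) σ → ∃₂ λ τ j → IsPerm n τ × j ≤ n × insertMin τ j ≡ σ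
insertMin-surjective {n} {σ} P with IsPerm-surjective P z<s
... | j , j<1+n , σj≡0 = τ , j , Pτ , ≤-pred j<1+n , apply-ext _ σ (trans (length-insertMin Pτ j) (sym (length≡ P))) same
  where
  σ≢0 : ∀ {p} → p < suc n → p ≢ j → apply σ p ≢ 0
  σ≢0 p<1+n p≢j σp≡0 = p≢j (apply-injective P p<1+n j<1+n (trans σp≡0 (sym σj≡0)))
  f : ℕ → ℕ
  f p = pred (apply σ (punchIn j p))
  τ = applyUpTo f n
  suc-f : ∀ {p} → p < n → suc (f p) ≡ apply σ (punchIn j p)
  suc-f {p} p<n = suc-pred-≢0 (σ≢0 (punchIn-< j p<n) (punchIn≢ j p))
    where
    suc-pred-≢0 : ∀ {x} → x ≢ 0 → suc (pred x) ≡ x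
    suc-pred-≢0 {zero}  x≢0 = contradiction refl x≢0
    suc-pred-≢0 {suc x} _   = refl
  f< : ∀ {p} → p < n → f p < n
  f< p<n = ≤-pred (subst (_< suc n) (sym (suc-f p<n)) (apply-< P (punchIn-< j p<n)))
  f-injective : ∀ {p q} → p < n → q < n → f p ≡ f q → p ≡ q
  f-injective {p} {q} p<n q<n eq = begin
    p                       ≡⟨ punchOut-punchIn j p ⟨
    punchOut j (punchIn j p) ≡⟨ cong (punchOut j) (apply-injective P (punchIn-< j p<n) (punchIn-< j q<n)
                                  (trans (sym (suc-f p<n)) (trans (cong suc eq) (suc-f q<n)))) ⟩
    punchOut j (punchIn j q) ≡⟨ punchOut-punchIn j q ⟩
    q                       ∎
    where open ≡-Reasoning
  Pτ : IsPerm n τ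
  Pτ = applyUpTo-IsPerm f n f< f-injective
  same : ∀ {p} → p < length (insertMin τ j) → apply (insertMin τ j) p ≡ apply σ p
  same {p} p<len with p ≟ j
  ... | yes refl = trans (apply-insertZeroAt-at p (map suc τ)) (sym σj≡0)
  ... | no p≢j = begin
    apply (insertMin τ j) p                  ≡⟨ apply-insertMin-≢ Pτ (≤-pred j<1+n) p<1+n p≢j ⟩
    suc (apply τ (punchOut j p))             ≡⟨ cong suc (apply-applyUpTo f p′<n) ⟩
    suc (f (punchOut j p))                   ≡⟨ suc-f p′<n ⟩
    apply σ (punchIn j (punchOut j p))       ≡⟨ cong (apply σ) (punchIn-punchOut p≢j) ⟩
    apply σ p                                ∎
    where
    open ≡-Reasoning
    p<1+n = subst (p <_) (length-insertMin Pτ j) p<len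
    p′<n  = punchOut-< (≤-pred j<1+n) p<1+n p≢j

recordsAbove-map-suc : ∀ t xs → recordsAbove (suc t) (map suc xs) ≡ recordsAbove t xs
recordsAbove-map-suc t []       = refl
recordsAbove-map-suc t (x ∷ xs) = cong (indicator (t <ᵇ x) +_) (recordsAbove-map-suc (t ⊔ x) xs)

recordsAbove-insertZeroAt : ∀ t j xs → recordsAbove t (insertZeroAt j xs) ≡ recordsAbove t xs
recordsAbove-insertZeroAt t zero    xs       = cong (λ u → recordsAbove u xs) (⊔-identityʳ t)
recordsAbove-insertZeroAt t (suc j) []       = refl
recordsAbove-insertZeroAt t (suc j) (x ∷ xs) = cong (indicator (t <ᵇ x) +_) (recordsAbove-insertZeroAt (t ⊔ x) j xs)

records-insertMin-zero : ∀ τ → records (insertMin τ 0) ≡ suc (records τ)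
records-insertMin-zero []      = refl
records-insertMin-zero (a ∷ τ) = cong (suc ∘ suc) (recordsAbove-map-suc a τ)

records-insertMin-suc : ∀ a τ j → records (insertMin (a ∷ τ) (suc j)) ≡ records (a ∷ τ)
records-insertMin-suc a τ j =
  cong suc (trans (recordsAbove-insertZeroAt (suc a) j (map suc τ)) (recordsAbove-map-suc a τ))

recordsInsertion : Insertion (λ _ → records)
recordsInsertion = record
  { insert            = λ _ → insertMin
  ; insert-IsPerm     = λ P → insertMin-IsPerm P
  ; insert-injective  = insertMin-injective
  ; insert-surjective = insertMin-surjective
  ; newSlot           = λ _ → 0
  ; newSlot≤          = λ _ → z≤n
  ; stat-newSlot      = λ {_} {τ} _ → records-insertMin-zero τ
  ; stat-insert       = stat-insert
  }
  where
  stat-insert : ∀ {n τ j} → IsPerm n τ → j ≤ n → j ≢ 0 → records (insertMin τ j) ≡ records τ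
  stat-insert {τ = τ} {zero} _ _ j≢0 = contradiction refl j≢0
  stat-insert {τ = []} {suc j} P j<n _ = contradiction (length≡ P) (λ 0≡n → <⇒≢ (≤-trans z<s j<n) 0≡n)
  stat-insert {τ = a ∷ τ} {suc j} _ _ _ = records-insertMin-suc a τ j

-- Cycles: inserting n into a cycle

transpose : ℕ → ℕ → ℕ → ℕ
transpose i n p = if p ≡ᵇ i then n else if p ≡ᵇ n then i else p

transpose-i : ∀ i n → transpose i n i ≡ n
transpose-i i n rewrite ≡ᵇ-true {i} refl = refl

transpose-n : ∀ i n → transpose i n n ≡ i
transpose-n i n with n ≟ i
... | yes refl rewrite ≡ᵇ-true {n} refl = refl
... | no n≢i   rewrite ≡ᵇ-false n≢i | ≡ᵇ-true {n} refl = refl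

transpose-other : ∀ {i n p} → p ≢ i → p ≢ n → transpose i n p ≡ p
transpose-other p≢i p≢n rewrite ≡ᵇ-false p≢i | ≡ᵇ-false p≢n = refl

transpose-involutive : ∀ i n p → transpose i n (transpose i n p) ≡ p
transpose-involutive i n p with p ≟ i | p ≟ n
... | yes refl | _        = trans (cong (transpose p n) (transpose-i p n)) (transpose-n p n)
... | no _     | yes refl = trans (cong (transpose i p) (transpose-n i p)) (transpose-i i p)
... | no p≢i   | no p≢n   = trans (cong (transpose i n) (transpose-other p≢i p≢n)) (transpose-other p≢i p≢n)

transpose-injective : ∀ i n {p q} → transpose i n p ≡ transpose i n q → p ≡ q
transpose-injective i n {p} {q} eq =
  trans (sym (transpose-involutive i n p)) (trans (cong (transpose i n) eq) (transpose-involutive i n q))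

transpose-< : ∀ {i n p} → i < suc n → p < suc n → transpose i n p < suc n
transpose-< {i} {n} {p} i<1+n p<1+n with p ≟ i | p ≟ n
... | yes refl | _        = subst (_< suc n) (sym (transpose-i p n)) ≤-refl
... | no _     | yes refl = subst (_< suc p) (sym (transpose-n i p)) i<1+n
... | no p≢i   | no p≢n   = subst (_< suc n) (sym (transpose-other p≢i p≢n)) p<1+n

extendFix : ℕ → List ℕ → ℕ → ℕ
extendFix n τ x = if x ≡ᵇ n then n else apply τ x

extendFix-n : ∀ n τ → extendFix n τ n ≡ n
extendFix-n n τ rewrite ≡ᵇ-true {n} refl = refl

extendFix-< : ∀ {n} τ {x} → x < n → extendFix n τ x ≡ apply τ x
extendFix-< τ x<n rewrite ≡ᵇ-false (<⇒≢ x<n) = refl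

module _ {n τ} (P : IsPerm n τ) where

  extendFix-<suc : ∀ {x} → x < suc n → extendFix n τ x < suc n
  extendFix-<suc {x} x<1+n with x ≟ n
  ... | yes refl = subst (_< suc x) (sym (extendFix-n x τ)) ≤-refl
  ... | no x≢n   = subst (_< suc n) (sym (extendFix-< τ x<n)) (m<n⇒m<1+n (apply-< P x<n))
    where x<n = ≤∧≢⇒< (≤-pred x<1+n) x≢n

  extendFix-≡n : ∀ {x} → x < suc n → extendFix n τ x ≡ n → x ≡ n
  extendFix-≡n {x} x<1+n eq with x ≟ n
  ... | yes x≡n = x≡n
  ... | no x≢n  = contradiction (trans (sym (extendFix-< τ x<n)) eq) (<⇒≢ (apply-< P x<n))
    where x<n = ≤∧≢⇒< (≤-pred x<1+n) x≢n

  extendFix-injective : ∀ {x y} → x < suc n → y < suc n → extendFix n τ x ≡ extendFix n τ y → x ≡ y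
  extendFix-injective {x} {y} x<1+n y<1+n eq with x ≟ n | y ≟ n
  ... | yes refl | _        = sym (extendFix-≡n y<1+n (trans (sym eq) (extendFix-n x τ)))
  ... | no _     | yes refl = extendFix-≡n x<1+n (trans eq (extendFix-n y τ))
  ... | no x≢n   | no y≢n   = apply-injective P x<n y<n
                                (trans (sym (extendFix-< τ x<n)) (trans eq (extendFix-< τ y<n)))
    where
    x<n = ≤∧≢⇒< (≤-pred x<1+n) x≢n
    y<n = ≤∧≢⇒< (≤-pred y<1+n) y≢n

-- σ = τ ∘ (i n): in cycle notation n is inserted right after i, and is a new fixed point if i = n.
insertIntoCycle : ℕ → List ℕ → ℕ → List ℕ
insertIntoCycle n τ i = applyUpTo (extendFix n τ ∘ transpose i n) (suc n)

module _ (n : ℕ) (τ : List ℕ) (i : ℕ) where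

  apply-insertIntoCycle : ∀ {p} → p < suc n → apply (insertIntoCycle n τ i) p ≡ extendFix n τ (transpose i n p)
  apply-insertIntoCycle = apply-applyUpTo (extendFix n τ ∘ transpose i n)

  insertIntoCycle-i : i < suc n → apply (insertIntoCycle n τ i) i ≡ n
  insertIntoCycle-i i<1+n = trans (apply-insertIntoCycle i<1+n) (trans (cong (extendFix n τ) (transpose-i i n)) (extendFix-n n τ))

  insertIntoCycle-n : i < n → apply (insertIntoCycle n τ i) n ≡ apply τ i
  insertIntoCycle-n i<n = trans (apply-insertIntoCycle ≤-refl) (trans (cong (extendFix n τ) (transpose-n i n)) (extendFix-< τ i<n))

  insertIntoCycle-other : ∀ {y} → y < n → y ≢ i → apply (insertIntoCycle n τ i) y ≡ apply τ y
  insertIntoCycle-other y<n y≢i = trans (apply-insertIntoCycle (m<n⇒m<1+n y<n))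
    (trans (cong (extendFix n τ) (transpose-other y≢i (<⇒≢ y<n))) (extendFix-< τ y<n))

insertIntoCycle-IsPerm : ∀ {n τ i} → IsPerm n τ → i ≤ n → IsPerm (suc n) (insertIntoCycle n τ i)
insertIntoCycle-IsPerm {n} {τ} {i} P i≤n = applyUpTo-IsPerm (extendFix n τ ∘ transpose i n) (suc n)
  (λ p<1+n → extendFix-<suc P (transpose-< (s≤s i≤n) p<1+n))
  (λ p<1+n q<1+n eq → transpose-injective i n
     (extendFix-injective P (transpose-< (s≤s i≤n) p<1+n) (transpose-< (s≤s i≤n) q<1+n) eq))

insertIntoCycle-injective : ∀ {n τ τ′ i i′} → IsPerm n τ → IsPerm n τ′ → i ≤ n → i′ ≤ n →
                            insertIntoCycle n τ i ≡ insertIntoCycle n τ′ i′ → τ ≡ τ′ × i ≡ i′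
insertIntoCycle-injective {n} {τ} {τ′} {i} {i′} P P′ i≤n i′≤n eq
  with refl ← apply-injective (insertIntoCycle-IsPerm P i≤n) (s≤s i≤n) (s≤s i′≤n)
                (trans (insertIntoCycle-i n τ i (s≤s i≤n)) (sym (trans (cong (λ σ → apply σ i′) eq) (insertIntoCycle-i n τ′ i′ (s≤s i′≤n)))))
  = apply-ext τ τ′ (trans (length≡ P) (sym (length≡ P′))) same , refl
  where
  same : ∀ {p} → p < length τ → apply τ p ≡ apply τ′ p
  same {p} p<len = begin
    apply τ p                                                  ≡⟨ extendFix-< τ p<n ⟨
    extendFix n τ p                                            ≡⟨ cong (extendFix n τ) (transpose-involutive i n p) ⟨
    extendFix n τ (transpose i n (transpose i n p))            ≡⟨ apply-insertIntoCycle n τ i t<1+n ⟨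
    apply (insertIntoCycle n τ i) (transpose i n p)            ≡⟨ cong (λ σ → apply σ (transpose i n p)) eq ⟩
    apply (insertIntoCycle n τ′ i) (transpose i n p)           ≡⟨ apply-insertIntoCycle n τ′ i t<1+n ⟩
    extendFix n τ′ (transpose i n (transpose i n p))           ≡⟨ cong (extendFix n τ′) (transpose-involutive i n p) ⟩
    extendFix n τ′ p                                           ≡⟨ extendFix-< τ′ p<n ⟩
    apply τ′ p                                                 ∎
    where
    open ≡-Reasoning
    p<n = subst (p <_) (length≡ P) p<len
    t<1+n = transpose-< (s≤s i≤n) (m<n⇒m<1+n p<n)

-- i is the preimage of n under σ, and τ = σ ∘ (i n) restricted to [0, n).
insertIntoCycle-surjective : ∀ {n σ} → IsPerm (suc n) σ → ∃₂ λ τ i → IsPerm n τ × i ≤ n × insertIntoCycle n τ i ≡ σ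
insertIntoCycle-surjective {n} {σ} P with IsPerm-surjective P (n<1+n n)
... | i , i<1+n , σi≡n = τ , i , Pτ , ≤-pred i<1+n ,
  apply-ext _ σ (trans (length-applyUpTo (extendFix n τ ∘ transpose i n) (suc n)) (sym (length≡ P))) same
  where
  f : ℕ → ℕ
  f p = apply σ (transpose i n p)
  τ = applyUpTo f n
  t<1+n : ∀ {p} → p < n → transpose i n p < suc n
  t<1+n p<n = transpose-< i<1+n (m<n⇒m<1+n p<n)
  f≢n : ∀ {p} → p < n → f p ≢ n
  f≢n {p} p<n fp≡n = <⇒≢ p<n (begin
    p                                                ≡⟨ transpose-involutive i n p ⟨
    transpose i n (transpose i n p)                  ≡⟨ cong (transpose i n) (apply-injective P (t<1+n p<n) i<1+n (trans fp≡n (sym σi≡n))) ⟩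
    transpose i n i                                  ≡⟨ transpose-i i n ⟩
    n                                                ∎)
    where open ≡-Reasoning
  Pτ : IsPerm n τ
  Pτ = applyUpTo-IsPerm f n (λ p<n → ≤∧≢⇒< (≤-pred (apply-< P (t<1+n p<n))) (f≢n p<n))
         (λ p<n q<n eq → transpose-injective i n (apply-injective P (t<1+n p<n) (t<1+n q<n) eq))
  same : ∀ {p} → p < length (insertIntoCycle n τ i) → apply (insertIntoCycle n τ i) p ≡ apply σ p
  same {p} p<len with p ≟ i
  ... | yes refl = trans (insertIntoCycle-i n τ i i<1+n) (sym σi≡n)
  ... | no p≢i = begin
    apply (insertIntoCycle n τ i) p                   ≡⟨ apply-insertIntoCycle n τ i p<1+n ⟩
    extendFix n τ (transpose i n p)                   ≡⟨ extendFix-< τ t<n ⟩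
    apply τ (transpose i n p)                         ≡⟨ apply-applyUpTo f t<n ⟩
    apply σ (transpose i n (transpose i n p))         ≡⟨ cong (apply σ) (transpose-involutive i n p) ⟩
    apply σ p                                         ∎
    where
    open ≡-Reasoning
    p<1+n = subst (p <_) (length-applyUpTo (extendFix n τ ∘ transpose i n) (suc n)) p<len
    t<n : transpose i n p < n
    t<n = ≤∧≢⇒< (≤-pred (transpose-< i<1+n p<1+n))
            (λ t≡n → p≢i (trans (sym (transpose-involutive i n p)) (trans (cong (transpose i n) t≡n) (transpose-n i n))))

IsOrbitMin : List ℕ → ℕ → Set
IsOrbitMin π x = ∀ k → x ≤ applyPow π k x

applyPow-+ : ∀ π k l x → applyPow π (k + l) x ≡ applyPow π k (applyPow π l x)
applyPow-+ π zero    l x = refl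
applyPow-+ π (suc k) l x = cong (apply π) (applyPow-+ π k l x)

applyPow-* : ∀ π {p x} → applyPow π p x ≡ x → ∀ q → applyPow π (q * p) x ≡ x
applyPow-* π         _    zero    = refl
applyPow-* π {p} {x} πᵖx≡x (suc q) = trans (applyPow-+ π p (q * p) x)
  (trans (cong (applyPow π p) (applyPow-* π πᵖx≡x q)) πᵖx≡x)

applyPow-% : ∀ π {p x} → applyPow π (suc p) x ≡ x → ∀ k → applyPow π k x ≡ applyPow π (k % suc p) x
applyPow-% π {p} {x} period k = begin
  applyPow π k x                                               ≡⟨ cong (λ l → applyPow π l x) (m≡m%n+[m/n]*n k (suc p)) ⟩
  applyPow π (k % suc p + k / suc p * suc p) x                 ≡⟨ applyPow-+ π (k % suc p) _ x ⟩
  applyPow π (k % suc p) (applyPow π (k / suc p * suc p) x)    ≡⟨ cong (applyPow π (k % suc p)) (applyPow-* π period (k / suc p)) ⟩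
  applyPow π (k % suc p) x                                     ∎
  where open ≡-Reasoning

module _ {m π} (P : IsPerm m π) where

  applyPow-< : ∀ {x} → x < m → ∀ k → applyPow π k x < m
  applyPow-< x<m zero    = x<m
  applyPow-< x<m (suc k) = apply-< P (applyPow-< x<m k)

  applyPow-cancel : ∀ {x} → x < m → ∀ a d → applyPow π a x ≡ applyPow π (a + d) x → x ≡ applyPow π d x
  applyPow-cancel x<m zero    d eq = eq
  applyPow-cancel x<m (suc a) d eq =
    applyPow-cancel x<m a d (apply-injective P (applyPow-< x<m a) (applyPow-< x<m (a + d)) eq)

  applyPow-period : ∀ {x} → x < m → ∃ λ p → 0 < p × p ≤ m × applyPow π p x ≡ x
  applyPow-period {x} x<m with pigeonhole-ℕ m (λ k → applyPow π k x) (λ {k} _ → applyPow-< x<m k)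
  ... | a , b , a<b , b≤m , eq = b ∸ a , m<n⇒0<n∸m a<b , ≤-trans (m∸n≤m b a) b≤m ,
    sym (applyPow-cancel x<m a (b ∸ a) (trans eq (cong (λ l → applyPow π l x) (sym (m+[n∸m]≡n (<⇒≤ a<b))))))

  -- isCycleMin checks the exponents 1, …, m; these cover a full period of x.
  isCycleMin⇒IsOrbitMin : ∀ {x} → x < m → T (isCycleMin m π x) → IsOrbitMin π x
  isCycleMin⇒IsOrbitMin {x} x<m check k with applyPow-period x<m
  ... | suc p , _ , p<m , period = subst (x ≤_) (sym (applyPow-% π period k)) (residue (k % suc p) (m%n<n k (suc p)))
    where
    residue : ∀ r → r < suc p → x ≤ applyPow π r x
    residue zero    _   = ≤-refl
    residue (suc j) j<p = ≤ᵇ⇒≤ _ _ (applyUpTo⁻ id m (all⁺ _ (upTo m) check) (<-≤-trans (<-trans (n<1+n j) j<p) p<m))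

IsOrbitMin⇒isCycleMin : ∀ {m π x} → IsOrbitMin π x → T (isCycleMin m π x)
IsOrbitMin⇒isCycleMin {m} {π} {x} orbitMin = all⁻ _ (applyUpTo⁺₁ id m (λ {k} _ → ≤⇒≤ᵇ (orbitMin (suc k))))

module _ {n τ i} (P : IsPerm n τ) (i≤n : i ≤ n) where

  private
    σ = insertIntoCycle n τ i

  -- Along the σ-orbit of x < n, the τ-orbit of x is traversed with the extra stop n after i.
  σ-orbit⊆τ-orbit : ∀ {x} → x < n → ∀ k →
    (∃ λ m → applyPow σ k x ≡ applyPow τ m x) ⊎ (applyPow σ k x ≡ n × ∃ λ m → applyPow τ m x ≡ i)
  σ-orbit⊆τ-orbit x<n zero = inj₁ (0 , refl)
  σ-orbit⊆τ-orbit {x} x<n (suc k) with σ-orbit⊆τ-orbit x<n k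
  ... | inj₂ (σᵏx≡n , m , τᵐx≡i) = inj₁ (suc m , (begin
    apply σ (applyPow σ k x)     ≡⟨ cong (apply σ) σᵏx≡n ⟩
    apply σ n                    ≡⟨ insertIntoCycle-n n τ i (subst (_< n) τᵐx≡i (applyPow-< P x<n m)) ⟩
    apply τ i                    ≡⟨ cong (apply τ) τᵐx≡i ⟨
    apply τ (applyPow τ m x)     ∎))
    where open ≡-Reasoning
  ... | inj₁ (m , σᵏx≡τᵐx) with applyPow τ m x ≟ i
  ...   | yes τᵐx≡i = inj₂ (trans (cong (apply σ) (trans σᵏx≡τᵐx τᵐx≡i)) (insertIntoCycle-i n τ i (s≤s i≤n)) , m , τᵐx≡i)
  ...   | no τᵐx≢i  = inj₁ (suc m , trans (cong (apply σ) σᵏx≡τᵐx) (insertIntoCycle-other n τ i (applyPow-< P x<n m) τᵐx≢i))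

  τ-orbit⊆σ-orbit : ∀ {x} → x < n → ∀ m → ∃ λ k → applyPow σ k x ≡ applyPow τ m x
  τ-orbit⊆σ-orbit x<n zero = 0 , refl
  τ-orbit⊆σ-orbit {x} x<n (suc m) with τ-orbit⊆σ-orbit x<n m | applyPow τ m x ≟ i
  ... | k , σᵏx≡τᵐx | no τᵐx≢i =
    suc k , trans (cong (apply σ) σᵏx≡τᵐx) (insertIntoCycle-other n τ i (applyPow-< P x<n m) τᵐx≢i)
  ... | k , σᵏx≡τᵐx | yes τᵐx≡i = suc (suc k) , (begin
    apply σ (apply σ (applyPow σ k x))   ≡⟨ cong (apply σ ∘ apply σ) (trans σᵏx≡τᵐx τᵐx≡i) ⟩
    apply σ (apply σ i)                  ≡⟨ cong (apply σ) (insertIntoCycle-i n τ i (s≤s i≤n)) ⟩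
    apply σ n                            ≡⟨ insertIntoCycle-n n τ i (subst (_< n) τᵐx≡i (applyPow-< P x<n m)) ⟩
    apply τ i                            ≡⟨ cong (apply τ) τᵐx≡i ⟨
    apply τ (applyPow τ m x)             ∎)
    where open ≡-Reasoning

  isCycleMin-insertIntoCycle-< : ∀ {x} → x < n → isCycleMin (suc n) σ x ≡ isCycleMin n τ x
  isCycleMin-insertIntoCycle-< {x} x<n = T-⇔⇒≡
    (λ σ-min → IsOrbitMin⇒isCycleMin {n} (τ-min (isCycleMin⇒IsOrbitMin (insertIntoCycle-IsPerm P i≤n) (m<n⇒m<1+n x<n) σ-min)))
    (λ τ-min → IsOrbitMin⇒isCycleMin {suc n} (σ-min (isCycleMin⇒IsOrbitMin P x<n τ-min)))
    where
    τ-min : IsOrbitMin σ x → IsOrbitMin τ x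
    τ-min σ-min m with τ-orbit⊆σ-orbit x<n m
    ... | k , σᵏx≡τᵐx = subst (x ≤_) σᵏx≡τᵐx (σ-min k)
    σ-min : IsOrbitMin τ x → IsOrbitMin σ x
    σ-min τ-min k with σ-orbit⊆τ-orbit x<n k
    ... | inj₁ (m , σᵏx≡τᵐx) = subst (x ≤_) (sym σᵏx≡τᵐx) (τ-min m)
    ... | inj₂ (σᵏx≡n , _)   = subst (x ≤_) (sym σᵏx≡n) (<⇒≤ x<n)

  isCycleMin-insertIntoCycle-n : isCycleMin (suc n) σ n ≡ (i ≡ᵇ n)
  isCycleMin-insertIntoCycle-n with i ≟ n
  ... | yes refl rewrite ≡ᵇ-true {i} refl = reflects-true (T-reflects _) (IsOrbitMin⇒isCycleMin {suc i} (≤-reflexive ∘ sym ∘ fixed))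
    where
    fixed : ∀ k → applyPow σ k i ≡ i
    fixed zero    = refl
    fixed (suc k) = trans (cong (apply σ) (fixed k)) (insertIntoCycle-i i τ i (s≤s i≤n))
  ... | no i≢n rewrite ≡ᵇ-false i≢n = reflects-false (T-reflects _) λ n-min →
    <⇒≱ (subst (_< n) (sym (insertIntoCycle-n n τ i i<n)) (apply-< P i<n))
        (isCycleMin⇒IsOrbitMin (insertIntoCycle-IsPerm P i≤n) ≤-refl n-min 1)
    where i<n = ≤∧≢⇒< i≤n i≢n

  numCycles-insertIntoCycle : numCycles (suc n) σ ≡ numCycles n τ + indicator (i ≡ᵇ n)
  numCycles-insertIntoCycle = trans (countᵇ-upTo-suc (isCycleMin (suc n) σ) n)
    (cong₂ _+_ (countᵇ-cong (upTo n) (isCycleMin-insertIntoCycle-< ∘ ∈-upTo⁻)) (cong indicator isCycleMin-insertIntoCycle-n))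

cyclesInsertion : Insertion numCycles
cyclesInsertion = record
  { insert            = insertIntoCycle
  ; insert-IsPerm     = insertIntoCycle-IsPerm
  ; insert-injective  = insertIntoCycle-injective
  ; insert-surjective = insertIntoCycle-surjective
  ; newSlot           = id
  ; newSlot≤          = λ _ → ≤-refl
  ; stat-newSlot      = λ {n} {τ} P → trans (numCycles-insertIntoCycle P ≤-refl)
                          (trans (cong (λ b → numCycles n τ + indicator b) (≡ᵇ-true {n} refl)) (+-comm _ 1))
  ; stat-insert       = λ {n} {τ} P i≤n i≢n → trans (numCycles-insertIntoCycle P i≤n)
                          (trans (cong (λ b → numCycles n τ + indicator b) (≡ᵇ-false i≢n)) (+-identityʳ _))
  }

∸2≡ᵇsuc : ∀ r k → (r ∸ 2 ≡ᵇ suc k) ≡ (r ≡ᵇ 3 + k)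
∸2≡ᵇsuc zero          k = refl
∸2≡ᵇsuc (suc zero)    k = refl
∸2≡ᵇsuc (suc (suc r)) k = refl

coeffR-suc : ∀ n k → coeffR n (suc k) ≡ c n (3 + k)
coeffR-suc n k = begin
  countᵇ (λ σ → mmp σ ≡ᵇ suc k) (perms n)
    ≡⟨ countᵇ-cong (perms n) (λ {σ} σ∈ → cong (_≡ᵇ suc k) (mmp≡records∸2 σ (∈perms⇒distinct n σ∈))) ⟩
  countᵇ (λ σ → records σ ∸ 2 ≡ᵇ suc k) (perms n)
    ≡⟨ countᵇ-cong (perms n) (λ {σ} _ → ∸2≡ᵇsuc (records σ) k) ⟩
  distribution (λ _ → records) n (3 + k)
    ≡⟨ distribution-unique recordsInsertion cyclesInsertion refl n (3 + k) ⟩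
  distribution numCycles n (3 + k)
    ∎
  where open ≡-Reasoning

mainTheorem12 : (n : ℕ) → 3 ≤ n → coeffR n 1 ≡ c n 3
mainTheorem12 n _ = coeffR-suc n 0
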